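{- Let $n,k,t$ be positive integers with $t\ge n$, $\frac{n(n+1)}{2}=k\cdot t$, $2n>t$ and $t$ odd, and suppose $\rho'(n,k,t)=\alpha\, go\, \beta$ with $\alpha\in\{s,ge,go\}^*$ and $\beta\in\{m,s,ge,go\}^+$. Then (a) the first symbol of $\beta$ is $m$ if $|\beta|=1$, and (b) the first symbol of $\beta$ is $s$ if $|\beta|\ge 2$.
   Context: The algorithm $\Pi\mathit{Solve}(n,k,t)$, on an instance $(n,k,t)$ of positive integers with $t\ge n$ and $n(n+1)/2=kt$, tests the following cases in order: case $m$: if $2k\mid n$ or $2k\mid n+1$, it solves the instance directly (meander algorithm) and stops; case $s$: else if $t\ge 2n$, it recurses on $(n-2k,\ k,\ t-2(n-k)-1)$; case $ge$: else if $t<2n$ and $t$ even, it recurses on $(t-n-1,\ 2(k-n)+t-1,\ t/2)$; case $go$: else ($t<2n$, $t$ odd) it recurses on $(t-n-1,\ k-\frac{2n-t+1}{2},\ t)$. The run sequence $\rho'(n,k,t)\in\{m,s,ge,go\}^+$ is the sequence of case symbols of the successive calls, starting with the call on $(n,k,t)$. -}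

module Defs where

open import Data.Nat using (ℕ; _+_; _*_; _≤_; _<_)
open import Data.Nat.Divisibility using (_∣_)
open import Data.List using (List; []; _∷_)
open import Data.Sum using (_⊎_)
open import Relation.Nullary using (¬_)
open import Relation.Binary.PropositionalEquality using (_≡_)

data Sym : Set where
  m s ge go : Sym

MCase : ℕ → ℕ → Set
MCase n k = (2 * k ∣ n) ⊎ (2 * k ∣ n + 1)

-- Run n k t w : the run sequence ρ'(n,k,t) of ΠSolve(n,k,t) equals w.
-- The new parameters of a recursive call are given by equations over ℕ
-- (without truncated subtraction), e.g. n' = n - 2k is written n' + 2k = n.
data Run : ℕ → ℕ → ℕ → List Sym → Set where
  run-m  : ∀ {n k t} → MCase n k → Run n k t (m ∷ [])
  -- recurse on (n - 2k, k, t - 2(n-k) - 1)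
  run-s  : ∀ {n k t n' t' w} → ¬ MCase n k → 2 * n ≤ t →
           n' + 2 * k ≡ n → t' + 2 * n + 1 ≡ t + 2 * k →
           Run n' k t' w → Run n k t (s ∷ w)
  -- recurse on (t - n - 1, 2(k-n) + t - 1, t/2)
  run-ge : ∀ {n k t n' k' t' w} → ¬ MCase n k → t < 2 * n → 2 ∣ t →
           n' + n + 1 ≡ t → k' + 2 * n + 1 ≡ 2 * k + t → 2 * t' ≡ t →
           Run n' k' t' w → Run n k t (ge ∷ w)
  -- recurse on (t - n - 1, k - (2n - t + 1)/2, t)
  run-go : ∀ {n k t n' k' w} → ¬ MCase n k → t < 2 * n → ¬ (2 ∣ t) →
           n' + n + 1 ≡ t → 2 * k' + 2 * n + 1 ≡ 2 * k + t →
           Run n' k' t w → Run n k t (go ∷ w)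

module Submission where

-- A go-call on (n,k,t) (with t < 2n) recurses on (n',k',t) with
-- n' + n + 1 = t, keeping t.  From t < 2n we get n' < n; if also t < 2n'
-- held we would get n < n', which is absurd.  Hence the call following a go
-- satisfies t ≥ 2n', so it cannot be a ge- or go-case: it is an m-case, which
-- ends the run, or an s-case, which recurses and so has a nonempty tail.

open import Defs
open import Data.Nat using (ℕ; _+_; _*_; _≤_; _<_; s≤s; z≤n)
open import Data.Nat.Divisibility using (_∣_)
open import Data.Nat.Properties using (+-comm; +-cancelʳ-<; +-identityʳ; <-trans; m<m+n; <-asym)
open import Data.List using (List; []; _∷_; _++_)
open import Data.List.Relation.Unary.All using (All)
open import Data.Product using (_×_; _,_; ∃-syntax)
open import Data.Empty using (⊥-elim)
open import Relation.Nullary using (¬_)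
open import Relation.Binary.PropositionalEquality using (_≡_; _≢_; refl; subst; cong)

sum-lt-double : ∀ a b → a + b + 1 < 2 * b → a < b
sum-lt-double a b h = +-cancelʳ-< b a b a+b<b+b
  where
  a+b<b+b : a + b < b + b
  a+b<b+b = subst (a + b <_) (cong (b +_) (+-identityʳ b))
                  (<-trans (m<m+n (a + b) (s≤s z≤n)) h)

-- The first parameter n' of the call after a go-case on (n,k,t) satisfies
-- 2n' ≤ t: both t < 2n and t < 2n' would force n' < n < n'.
go-successor-small : ∀ n n' {t} → t < 2 * n → n' + n + 1 ≡ t → ¬ (t < 2 * n')
go-successor-small n n' t<2n refl t<2n' =
  <-asym (sum-lt-double n' n t<2n)
         (sum-lt-double n n' (subst (λ x → x + 1 < 2 * n') (+-comm n' n) t<2n'))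

run-nonempty : ∀ {n k t w} → Run n k t w → w ≢ []
run-nonempty (run-m _)               ()
run-nonempty (run-s _ _ _ _ _)       ()
run-nonempty (run-ge _ _ _ _ _ _ _)  ()
run-nonempty (run-go _ _ _ _ _ _)    ()

HeadShape : Sym → List Sym → Set
HeadShape b β' = (β' ≡ [] → b ≡ m) × (β' ≢ [] → b ≡ s)

large-t-head : ∀ {n k t b β'} → ¬ (t < 2 * n) → Run n k t (b ∷ β') → HeadShape b β'
large-t-head _ (run-m _)               = (λ _ → refl) , (λ β'≢[] → ⊥-elim (β'≢[] refl))
large-t-head _ (run-s _ _ _ _ r)       = (λ β'≡[] → ⊥-elim (run-nonempty r β'≡[])) , (λ _ → refl)
large-t-head ¬t<2n (run-ge _ t<2n _ _ _ _ _) = ⊥-elim (¬t<2n t<2n)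
large-t-head ¬t<2n (run-go _ t<2n _ _ _ _)   = ⊥-elim (¬t<2n t<2n)

after-go : ∀ {n k t b β'} → Run n k t (go ∷ b ∷ β') → HeadShape b β'
after-go {n} (run-go {n' = n'} _ t<2n _ n'+n+1≡t _ r) =
  large-t-head (go-successor-small n n' t<2n n'+n+1≡t) r

run-suffix : ∀ α {n k t w b β} → Run n k t w → w ≡ α ++ b ∷ β →
             ∃[ n' ] ∃[ k' ] ∃[ t' ] Run n' k' t' (b ∷ β)
run-suffix []          r                       refl = _ , _ , _ , r
run-suffix (_ ∷ [])    (run-m _)               ()
run-suffix (_ ∷ _ ∷ _) (run-m _)               ()
run-suffix (_ ∷ α)     (run-s _ _ _ _ r)       refl = run-suffix α r refl
run-suffix (_ ∷ α)     (run-ge _ _ _ _ _ _ r)  refl = run-suffix α r refl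
run-suffix (_ ∷ α)     (run-go _ _ _ _ _ r)    refl = run-suffix α r refl

lemma7 : ∀ (n k t : ℕ) → 0 < n → 0 < k → 0 < t → n ≤ t →
    n * (n + 1) ≡ 2 * (k * t) → t < 2 * n → ¬ (2 ∣ t) →
    ∀ (w α : List Sym) (b : Sym) (β' : List Sym) →
    Run n k t w → w ≡ α ++ (go ∷ b ∷ β') → All (λ x → x ≢ m) α →
    (β' ≡ [] → b ≡ m) × (β' ≢ [] → b ≡ s)
lemma7 n k t _ _ _ _ _ _ _ w α b β' r w≡α++go∷b∷β' _
  with run-suffix α r w≡α++go∷b∷β'
... | _ , _ , _ , r-from-go = after-go r-from-go
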